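{- Let $p\geq 3$ be a prime and let $r$ be an integer with $1\leq r\leq p-1$ such that $\left(\frac{8r+1}{p}\right)_L=-1$. Then for all integers $n\geq 0$, \[ T_2(9(pn+r)+1)\equiv 0 \pmod 6. \]
   Context: $\left(\frac{a}{p}\right)_L$ denotes the Legendre symbol. A partition is $2$-regular if none of its parts is even. $T_2(n)$ denotes the number of triples $(\xi_1,\xi_2,\xi_3)$ of $2$-regular partitions whose sizes sum to $n$; equivalently \[ \sum_{n\geq 0}T_2(n)q^n=\prod_{i\geq 1}\frac{(1-q^{2i})^3}{(1-q^i)^3}. \] -}

module Defs where

open import Data.Nat using (ℕ; zero; suc; _+_; _*_; _∸_; _%_; _≡ᵇ_; _<ᵇ_)
open import Data.Nat.ListAction using (sum)
open import Data.Bool.ListAction using (any)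
open import Data.Integer using (ℤ; +_; -[1+_])
open import Data.Bool using (Bool; true; false; if_then_else_)
open import Data.List using (List; map; upTo)

-- oddPartsAux k m f = number of partitions of m into odd parts ≤ k
-- (f is fuel; f ≥ m suffices since each step removes a positive part).
oddPartsAux : ℕ → ℕ → ℕ → ℕ
oddPartsAux zero    zero    _       = 1
oddPartsAux zero    (suc _) _       = 0
oddPartsAux (suc k) m       zero    = if m ≡ᵇ 0 then 1 else 0
oddPartsAux (suc k) m       (suc f) =
  oddPartsAux k m (suc f) +
  (if (suc k) % 2 ≡ᵇ 1
     then (if m <ᵇ suc k then 0 else oddPartsAux (suc k) (m ∸ suc k) f)
     else 0)

pod : ℕ → ℕ
pod m = oddPartsAux m m m

T₂ : ℕ → ℕ
T₂ n = sum (map (λ a → sum (map (λ b → pod a * pod b * pod (n ∸ a ∸ b))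
                                 (upTo (suc (n ∸ a)))))
                (upTo (suc n)))

isQRᵇ : ℕ → ℕ → Bool
isQRᵇ a zero    = false
isQRᵇ a (suc q) = any (λ x → ((x * x) % suc q) ≡ᵇ (a % suc q)) (upTo (suc q))

legendre : ℕ → ℕ → ℤ
legendre a zero    = + 0
legendre a (suc q) =
  if (a % suc q) ≡ᵇ 0 then + 0
  else (if isQRᵇ a (suc q) then + 1 else -[1+ 0 ])

module Submission where

-- Over ℕ, Σ T₂(n) qⁿ is the cube of F = Σ pod(n) qⁿ. Writing F = c + q G, the cube is
-- c³ + q³ G³ plus three times a series, so by induction every coefficient of F³ in a
-- degree ≡ 1 (mod 3) is divisible by 3.
--
-- Modulo 2 all signs disappear, and F = 1 / (−q; q²)_∞ = (−q; q)_∞ by Euler's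
-- odd/distinct argument. Hence F³ = (−q; q⁴)_∞ (−q³; q⁴)_∞ (−q⁴; q⁴)_∞, and Jacobi's
-- triple product identity (obtained here from Euler's expansion of
-- (−q^a; q⁴)_∞ (−q⁴; q⁴)_∞ by multiplying in one factor (1 + q^(4M+3)) at a time) shows
-- that this is Σ q^(m(2m+1)) over m ∈ ℤ, i.e. the sum of q^t over the triangular numbers t.
-- So T₂(t) is odd only if 8t + 1 is a square. For t = 9(pn + r) + 1 we have
-- 8t + 1 = 9 (8(pn + r) + 1), and a square of that form would make 8r + 1 a square modulo p.

open import Level using (0ℓ)
open import Function using (_∘_)
open import Algebra.Core using (Op₂)
open import Algebra.Bundles using (CommutativeSemiring; CommutativeRing)
open import Algebra.Structures using (IsCommutativeSemiring)
open import Algebra.Structures.Biased using (isCommutativeSemiringˡ)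
import Algebra.Solver.Ring.NaturalCoefficients.Default
open import Data.Bool using (Bool; true; false; if_then_else_; not; _xor_; _∧_; T)
open import Data.Bool.Properties
  using (¬-not; xor-∧-commutativeRing; xor-same; xor-assoc; xor-identityʳ; not-distribˡ-xor; not-involutive)
open import Data.Empty using (⊥-elim)
open import Data.Integer using (-[1+_])
open import Data.List using (map; upTo; applyUpTo)
open import Data.List.Properties using (map-cong; map-upTo)
open import Data.List.Membership.Propositional.Properties using (∈-upTo⁺)
import Data.List.Relation.Unary.Any as Any
open import Data.List.Relation.Unary.Any.Properties using (any⁺)
open import Data.Nat as ℕ using (ℕ; zero; suc; _≤_; _<_; z≤n; s≤s; _∸_; _%_; _≡ᵇ_; _<ᵇ_; NonZero)
open import Data.Nat.Properties as ℕₚ using (<ᵇ-reflects-<)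
open import Data.Nat.DivMod using ([m+kn]%n≡m%n; %-distribˡ-*; m%n<n)
open import Data.Nat.Divisibility using (_∣_; divides; ∣m∣n⇒∣m+n; m∣m*n; ∣-refl)
open import Data.Nat.Induction using (<-rec)
open import Data.Nat.LCM using (lcm-least)
open import Data.Nat.ListAction using (sum)
open import Data.Nat.Primality using (Prime; prime?; euclidsLemma)
open import Data.Nat.Tactic.RingSolver using (solve-∀)
open import Data.Product using (∃; _,_; _×_; proj₁; proj₂)
open import Data.Sum using (inj₁; inj₂; [_,_]′)
open import Relation.Binary.Bundles using (Setoid)
open import Relation.Binary.PropositionalEquality
import Relation.Binary.Reasoning.Setoid
open import Relation.Nullary using (contradiction; ofʸ; ofⁿ)
open import Relation.Nullary.Decidable using (from-yes)

open import Defs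

a+s*0≡a : ∀ a s → a ℕ.+ s ℕ.* 0 ≡ a
a+s*0≡a a s = trans (cong (a ℕ.+_) (ℕₚ.*-zeroʳ s)) (ℕₚ.+-identityʳ a)

a+s*[1+N]≡a+s+s*N : ∀ a s N → a ℕ.+ s ℕ.* suc N ≡ a ℕ.+ s ℕ.+ s ℕ.* N
a+s*[1+N]≡a+s+s*N a s N = trans (cong (a ℕ.+_) (ℕₚ.*-suc s N)) (sym (ℕₚ.+-assoc a s (s ℕ.* N)))

<⇒<+* : ∀ {d N} a s .{{_ : NonZero s}} → d < N → d < a ℕ.+ s ℕ.* N
<⇒<+* {N = N} a s d<N = ℕₚ.<-≤-trans d<N (ℕₚ.≤-trans (ℕₚ.m≤n*m N s) (ℕₚ.m≤n+m (s ℕ.* N) a))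

module PowerSeries {A : Set} {_+ᴬ_ _*ᴬ_ : Op₂ A} {0ᴬ 1ᴬ : A}
                   (isCommutativeSemiring : IsCommutativeSemiring _≡_ _+ᴬ_ _*ᴬ_ 0ᴬ 1ᴬ) where

  coefficients : CommutativeSemiring 0ℓ 0ℓ
  coefficients = record { isCommutativeSemiring = isCommutativeSemiring }

  open CommutativeSemiring coefficients
    using ( _+_; _*_; 0#; 1#; +-assoc; +-comm; +-identityˡ; +-identityʳ; *-assoc; *-comm
          ; *-identityˡ; *-identityʳ; distribˡ; distribʳ; zeroˡ; zeroʳ; +-commutativeSemigroup)
  open import Algebra.Properties.CommutativeSemigroup +-commutativeSemigroup
    using (interchange; x∙yz≈y∙xz)
  module ≗-Reasoning = Relation.Binary.Reasoning.Setoid (ℕ →-setoid A)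

  Series : Set
  Series = ℕ → A

  ≗-sym : ∀ {f g : Series} → f ≗ g → g ≗ f
  ≗-sym f≗g n = sym (f≗g n)

  infix 4 _≗[_]_
  _≗[_]_ : Series → ℕ → Series → Set
  f ≗[ d ] g = ∀ n → n ≤ d → f n ≡ g n

  ≗[]-refl : ∀ {f d} → f ≗[ d ] f
  ≗[]-refl _ _ = refl

  ≗⇒≗[] : ∀ {f g d} → f ≗ g → f ≗[ d ] g
  ≗⇒≗[] f≗g n _ = f≗g n

  ≗[]-sym : ∀ {f g d} → f ≗[ d ] g → g ≗[ d ] f
  ≗[]-sym f≗g n n≤d = sym (f≗g n n≤d)

  ≗[]-trans : ∀ {f g h d} → f ≗[ d ] g → g ≗[ d ] h → f ≗[ d ] h
  ≗[]-trans f≗g g≗h n n≤d = trans (f≗g n n≤d) (g≗h n n≤d)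

  ≗[]-mono : ∀ {f g d e} → e ≤ d → f ≗[ d ] g → f ≗[ e ] g
  ≗[]-mono e≤d f≗g n n≤e = f≗g n (ℕₚ.≤-trans n≤e e≤d)

  ∀≗[]⇒≗ : ∀ {f g} → (∀ d → f ≗[ d ] g) → f ≗ g
  ∀≗[]⇒≗ f≗g n = f≗g n n ℕₚ.≤-refl

  const : A → Series
  const c zero    = c
  const c (suc _) = 0#

  0ˢ 1ˢ : Series
  0ˢ _ = 0#
  1ˢ = const 1#

  infixl 6 _⊕_
  infixr 7 _⊙_
  infixl 7 _·_

  _⊕_ : Series → Series → Series
  (f ⊕ g) n = f n + g n

  _⊙_ : A → Series → Series
  (c ⊙ f) n = c * f n

  tail : Series → Series
  tail f n = f (suc n)

  shift : ℕ → Series → Series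
  shift zero    f         = f
  shift (suc e) f zero    = 0#
  shift (suc e) f (suc n) = shift e f n

  _·_ : Series → Series → Series
  (f · g) zero    = f 0 * g 0
  (f · g) (suc n) = f 0 * g (suc n) + (tail f · g) n

  ⊕-cong : ∀ {f f′ g g′} → f ≗ f′ → g ≗ g′ → f ⊕ g ≗ f′ ⊕ g′
  ⊕-cong f≗f′ g≗g′ n = cong₂ _+_ (f≗f′ n) (g≗g′ n)

  ⊕-congˡ : ∀ h {f g} → f ≗ g → h ⊕ f ≗ h ⊕ g
  ⊕-congˡ h f≗g n = cong (h n +_) (f≗g n)

  ·-coeff-cong : ∀ n {f f′ g g′} → f ≗[ n ] f′ → g ≗[ n ] g′ → (f · g) n ≡ (f′ · g′) n
  ·-coeff-cong zero    f≗f′ g≗g′ = cong₂ _*_ (f≗f′ 0 z≤n) (g≗g′ 0 z≤n)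
  ·-coeff-cong (suc n) f≗f′ g≗g′ =
    cong₂ _+_ (cong₂ _*_ (f≗f′ 0 z≤n) (g≗g′ (suc n) ℕₚ.≤-refl))
              (·-coeff-cong n (λ m m≤n → f≗f′ (suc m) (s≤s m≤n)) (≗[]-mono (ℕₚ.n≤1+n n) g≗g′))

  ·-cong≤ : ∀ {f f′ g g′ d} → f ≗[ d ] f′ → g ≗[ d ] g′ → f · g ≗[ d ] f′ · g′
  ·-cong≤ f≗f′ g≗g′ n n≤d = ·-coeff-cong n (≗[]-mono n≤d f≗f′) (≗[]-mono n≤d g≗g′)

  ·-cong : ∀ {f f′ g g′} → f ≗ f′ → g ≗ g′ → f · g ≗ f′ · g′
  ·-cong f≗f′ g≗g′ n = ·-coeff-cong n (≗⇒≗[] f≗f′) (≗⇒≗[] g≗g′)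

  ·-congˡ : ∀ h {f g} → f ≗ g → h · f ≗ h · g
  ·-congˡ h f≗g n = ·-coeff-cong n (λ _ _ → refl) (≗⇒≗[] f≗g)

  shift-cong : ∀ e {f g} → f ≗ g → shift e f ≗ shift e g
  shift-cong zero    f≗g n       = f≗g n
  shift-cong (suc e) f≗g zero    = refl
  shift-cong (suc e) f≗g (suc n) = shift-cong e f≗g n

  ⊕-assoc : ∀ f g h → (f ⊕ g) ⊕ h ≗ f ⊕ (g ⊕ h)
  ⊕-assoc f g h n = +-assoc (f n) (g n) (h n)

  ⊕-comm : ∀ f g → f ⊕ g ≗ g ⊕ f
  ⊕-comm f g n = +-comm (f n) (g n)

  ⊕-identityˡ : ∀ f → 0ˢ ⊕ f ≗ f
  ⊕-identityˡ f n = +-identityˡ (f n)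

  ⊕-identityʳ : ∀ f → f ⊕ 0ˢ ≗ f
  ⊕-identityʳ f n = +-identityʳ (f n)

  ·-zeroˡ : ∀ g → 0ˢ · g ≗ 0ˢ
  ·-zeroˡ g zero    = zeroˡ (g 0)
  ·-zeroˡ g (suc n) = trans (cong₂ _+_ (zeroˡ _) (·-zeroˡ g n)) (+-identityˡ 0#)

  const-· : ∀ c g → const c · g ≗ c ⊙ g
  const-· c g zero    = refl
  const-· c g (suc n) = trans (cong (c * g (suc n) +_) (·-zeroˡ g n)) (+-identityʳ _)

  ·-identityˡ : ∀ g → 1ˢ · g ≗ g
  ·-identityˡ g n = trans (const-· 1# g n) (*-identityˡ (g n))

  ·-distribʳ : ∀ f g h → (f ⊕ g) · h ≗ f · h ⊕ g · h
  ·-distribʳ f g h zero    = distribʳ (h 0) (f 0) (g 0)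
  ·-distribʳ f g h (suc n) = begin
    (f 0 + g 0) * h (suc n) + ((tail f ⊕ tail g) · h) n
      ≡⟨ cong₂ _+_ (distribʳ _ _ _) (·-distribʳ (tail f) (tail g) h n) ⟩
    (f 0 * h (suc n) + g 0 * h (suc n)) + ((tail f · h) n + (tail g · h) n)
      ≡⟨ interchange _ _ _ _ ⟩
    (f 0 * h (suc n) + (tail f · h) n) + (g 0 * h (suc n) + (tail g · h) n) ∎
    where open ≡-Reasoning

  ·-tailʳ : ∀ f g n → (f · g) (suc n) ≡ f (suc n) * g 0 + (f · tail g) n
  ·-tailʳ f g zero    = +-comm _ _
  ·-tailʳ f g (suc n) = begin
    f 0 * g (suc (suc n)) + (tail f · g) (suc n)
      ≡⟨ cong (f 0 * g (suc (suc n)) +_) (·-tailʳ (tail f) g n) ⟩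
    f 0 * g (suc (suc n)) + (f (suc (suc n)) * g 0 + (tail f · tail g) n)
      ≡⟨ x∙yz≈y∙xz _ _ _ ⟩
    f (suc (suc n)) * g 0 + (f 0 * g (suc (suc n)) + (tail f · tail g) n) ∎
    where open ≡-Reasoning

  ·-comm : ∀ f g → f · g ≗ g · f
  ·-comm f g zero    = *-comm (f 0) (g 0)
  ·-comm f g (suc n) = begin
    f 0 * g (suc n) + (tail f · g) n ≡⟨ cong₂ _+_ (*-comm _ _) (·-comm (tail f) g n) ⟩
    g (suc n) * f 0 + (g · tail f) n ≡⟨ ·-tailʳ g f n ⟨
    (g · f) (suc n)                  ∎
    where open ≡-Reasoning

  ⊙-· : ∀ c f g → (c ⊙ f) · g ≗ c ⊙ (f · g)
  ⊙-· c f g zero    = *-assoc c (f 0) (g 0)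
  ⊙-· c f g (suc n) = begin
    c * f 0 * g (suc n) + ((c ⊙ tail f) · g) n ≡⟨ cong₂ _+_ (*-assoc _ _ _) (⊙-· c (tail f) g n) ⟩
    c * (f 0 * g (suc n)) + c * (tail f · g) n ≡⟨ distribˡ _ _ _ ⟨
    c * (f 0 * g (suc n) + (tail f · g) n)     ∎
    where open ≡-Reasoning

  ·-assoc : ∀ f g h → (f · g) · h ≗ f · (g · h)
  ·-assoc f g h zero    = *-assoc (f 0) (g 0) (h 0)
  ·-assoc f g h (suc n) = begin
    (f 0 * g 0) * h (suc n) + ((f 0 ⊙ tail g ⊕ tail f · g) · h) n
      ≡⟨ cong₂ _+_ (*-assoc _ _ _) (·-distribʳ (f 0 ⊙ tail g) (tail f · g) h n) ⟩
    f 0 * (g 0 * h (suc n)) + (((f 0 ⊙ tail g) · h) n + ((tail f · g) · h) n)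
      ≡⟨ cong (f 0 * (g 0 * h (suc n)) +_) (cong₂ _+_ (⊙-· (f 0) (tail g) h n) (·-assoc (tail f) g h n)) ⟩
    f 0 * (g 0 * h (suc n)) + (f 0 * (tail g · h) n + (tail f · (g · h)) n)
      ≡⟨ +-assoc _ _ _ ⟨
    (f 0 * (g 0 * h (suc n)) + f 0 * (tail g · h) n) + (tail f · (g · h)) n
      ≡⟨ cong (_+ (tail f · (g · h)) n) (distribˡ _ _ _) ⟨
    f 0 * (g 0 * h (suc n) + (tail g · h) n) + (tail f · (g · h)) n ∎
    where open ≡-Reasoning

  seriesSemiring : CommutativeSemiring 0ℓ 0ℓ
  seriesSemiring = record
    { Carrier = Series ; _≈_ = _≗_ ; _+_ = _⊕_ ; _*_ = _·_ ; 0# = 0ˢ ; 1# = 1ˢ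
    ; isCommutativeSemiring = isCommutativeSemiringˡ record
      { +-isCommutativeMonoid = record
        { isMonoid = record
          { isSemigroup = record
            { isMagma = record { isEquivalence = ≗-isEquivalence ; ∙-cong = ⊕-cong }
            ; assoc = ⊕-assoc }
          ; identity = ⊕-identityˡ , ⊕-identityʳ }
        ; comm = ⊕-comm }
      ; *-isCommutativeMonoid = record
        { isMonoid = record
          { isSemigroup = record
            { isMagma = record { isEquivalence = ≗-isEquivalence ; ∙-cong = ·-cong }
            ; assoc = ·-assoc }
          ; identity = ·-identityˡ , λ g n → trans (·-comm g 1ˢ n) (·-identityˡ g n) }
        ; comm = ·-comm }
      ; distribʳ = λ h f g → ·-distribʳ f g h
      ; zeroˡ = ·-zeroˡ
      }
    }
    where
    ≗-isEquivalence = Setoid.isEquivalence (ℕ →-setoid A)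

  shift-< : ∀ e f {n} → n < e → shift e f n ≡ 0#
  shift-< (suc e) f {zero}  _         = refl
  shift-< (suc e) f {suc n} (s≤s n<e) = shift-< e f n<e

  shift-+ : ∀ e f m → shift e f (e ℕ.+ m) ≡ f m
  shift-+ zero    f m = refl
  shift-+ (suc e) f m = shift-+ e f m

  shift-≥ : ∀ e f {n} → e ≤ n → shift e f n ≡ f (n ∸ e)
  shift-≥ e f {n} e≤n = trans (cong (shift e f) (sym (ℕₚ.m+[n∸m]≡n e≤n))) (shift-+ e f (n ∸ e))

  shift-⊕ : ∀ e f g → shift e (f ⊕ g) ≗ shift e f ⊕ shift e g
  shift-⊕ zero    f g n       = refl
  shift-⊕ (suc e) f g zero    = sym (+-identityˡ 0#)
  shift-⊕ (suc e) f g (suc n) = shift-⊕ e f g n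

  shift-shift : ∀ e e′ f → shift e (shift e′ f) ≗ shift (e ℕ.+ e′) f
  shift-shift zero    e′ f n       = refl
  shift-shift (suc e) e′ f zero    = refl
  shift-shift (suc e) e′ f (suc n) = shift-shift e e′ f n

  shift-· : ∀ e f g → shift e f · g ≗ shift e (f · g)
  shift-· zero    f g n       = refl
  shift-· (suc e) f g zero    = zeroˡ (g 0)
  shift-· (suc e) f g (suc n) =
    trans (cong (_+ (shift e f · g) n) (zeroˡ (g (suc n)))) (trans (+-identityˡ _) (shift-· e f g n))

  ·-shiftʳ : ∀ e f g → f · shift e g ≗ shift e (f · g)
  ·-shiftʳ e f g n = trans (·-comm f (shift e g) n) (trans (shift-· e g f n) (shift-cong e (·-comm g f) n))

  shift-·-shift : ∀ e e′ f g → shift e f · shift e′ g ≗ shift (e ℕ.+ e′) (f · g)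
  shift-·-shift e e′ f g n = trans (shift-· e f (shift e′ g) n)
    (trans (shift-cong e (·-shiftʳ e′ f g) n) (shift-shift e e′ (f · g) n))

  const-·-const : ∀ a b → const a · const b ≗ const (a * b)
  const-·-const a b zero    = refl
  const-·-const a b (suc n) = trans (const-· a (const b) (suc n)) (zeroʳ a)

  const⊕shift-tail : ∀ f → f ≗ const (f 0) ⊕ shift 1 (tail f)
  const⊕shift-tail f zero    = sym (+-identityʳ (f 0))
  const⊕shift-tail f (suc n) = sym (+-identityˡ (f (suc n)))

  infix 8 1+q^_
  1+q^_ : ℕ → Series
  1+q^ a = 1ˢ ⊕ shift a 1ˢ

  1+q^-· : ∀ a f → 1+q^ a · f ≗ f ⊕ shift a f
  1+q^-· a f n = trans (·-distribʳ 1ˢ (shift a 1ˢ) f n)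
    (cong₂ _+_ (·-identityˡ f n) (trans (shift-· a 1ˢ f n) (shift-cong a (·-identityˡ f) n)))

  1+q^-≗[]1ˢ : ∀ {a d} → d < a → 1+q^ a ≗[ d ] 1ˢ
  1+q^-≗[]1ˢ {a} d<a n n≤d = trans (cong (1ˢ n +_) (shift-< a 1ˢ (ℕₚ.≤-<-trans n≤d d<a))) (+-identityʳ _)

  poch : ℕ → ℕ → ℕ → Series
  poch a s zero    = 1ˢ
  poch a s (suc N) = 1+q^ a · poch (a ℕ.+ s) s N

  -- (-q^a; q^s)_∞: for s ≥ 1 the first n + 1 factors already determine the coefficient of q^n.
  poch∞ : ℕ → ℕ → Series
  poch∞ a s n = poch a s (suc n) n

  poch-≗[]1ˢ : ∀ {a d} s N → d < a → poch a s N ≗[ d ] 1ˢ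
  poch-≗[]1ˢ s zero    d<a = ≗[]-refl
  poch-≗[]1ˢ s (suc N) d<a =
    ≗[]-trans (·-cong≤ (1+q^-≗[]1ˢ d<a) (poch-≗[]1ˢ s N (ℕₚ.<-≤-trans d<a (ℕₚ.m≤m+n _ s))))
              (≗⇒≗[] (·-identityˡ 1ˢ))

  poch∞-≗[]1ˢ : ∀ {a d} s → d < a → poch∞ a s ≗[ d ] 1ˢ
  poch∞-≗[]1ˢ s d<a n n≤d = poch-≗[]1ˢ s (suc n) d<a n n≤d

  -- The factors with k ≥ N only affect coefficients of degree ≥ a + s N.
  poch-stable : ∀ {d} a s N N′ → d < a ℕ.+ s ℕ.* N → d < a ℕ.+ s ℕ.* N′ →
                poch a s N ≗[ d ] poch a s N′
  poch-stable {d} a s zero N′ d<a _ =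
    ≗[]-sym (poch-≗[]1ˢ s N′ (subst (d <_) (a+s*0≡a a s) d<a))
  poch-stable {d} a s (suc N) zero _ d<a =
    poch-≗[]1ˢ s (suc N) (subst (d <_) (a+s*0≡a a s) d<a)
  poch-stable {d} a s (suc N) (suc N′) d<N d<N′ =
    ·-cong≤ (≗[]-refl)
            (poch-stable (a ℕ.+ s) s N N′ (subst (d <_) (a+s*[1+N]≡a+s+s*N a s N) d<N)
                                          (subst (d <_) (a+s*[1+N]≡a+s+s*N a s N′) d<N′))

  poch∞-approx : ∀ {d} a s N .{{_ : NonZero s}} → d < a ℕ.+ s ℕ.* N → poch∞ a s ≗[ d ] poch a s N
  poch∞-approx a s N d<N n n≤d =
    poch-stable a s (suc n) N (<⇒<+* a s ℕₚ.≤-refl) (ℕₚ.≤-<-trans n≤d d<N) n ℕₚ.≤-refl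

  poch∞-suc : ∀ a s .{{_ : NonZero s}} → poch∞ a s ≗ 1+q^ a · poch∞ (a ℕ.+ s) s
  poch∞-suc a s n = ·-coeff-cong n (≗[]-refl)
    (≗[]-sym (poch∞-approx (a ℕ.+ s) s n (subst (n <_) (a+s*[1+N]≡a+s+s*N a s n) (<⇒<+* a s ℕₚ.≤-refl))))

  module Solver = Algebra.Solver.Ring.NaturalCoefficients.Default seriesSemiring
  open Solver using (solve; _:+_; _:*_; _:=_)

  cube : Series → Series
  cube f = f · (f · f)

  cube-⊕ : ∀ f g → let m = f · (f · g) ⊕ f · (g · g) in cube (f ⊕ g) ≗ cube f ⊕ cube g ⊕ (m ⊕ m ⊕ m)
  cube-⊕ = solve 2 (λ f g → let m = f :* (f :* g) :+ f :* (g :* g) in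
                     (f :+ g) :* ((f :+ g) :* (f :+ g)) := f :* (f :* f) :+ g :* (g :* g) :+ (m :+ m :+ m))
                   (λ _ → refl)

  cube-shift : ∀ e f → cube (shift e f) ≗ shift (e ℕ.+ (e ℕ.+ e)) (cube f)
  cube-shift e f n = trans (·-congˡ (shift e f) (shift-·-shift e e f f) n) (shift-·-shift e (e ℕ.+ e) f (f · f) n)

  cube-const : ∀ c → cube (const c) ≗ const (c * (c * c))
  cube-const c n = trans (·-congˡ (const c) (const-·-const c c) n) (const-·-const c (c * c) n)

  inverse-unique : ∀ {f g h} → f · g ≗ 1ˢ → f · h ≗ 1ˢ → g ≗ h
  inverse-unique {f} {g} {h} fg≗1 fh≗1 = begin
    g             ≈⟨ ·-identityˡ g ⟨
    1ˢ · g        ≈⟨ ·-cong fh≗1 (λ _ → refl) ⟨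
    (f · h) · g   ≈⟨ solve 3 (λ f g h → (f :* h) :* g := (f :* g) :* h) (λ _ → refl) f g h ⟩
    (f · g) · h   ≈⟨ ·-cong fg≗1 (λ _ → refl) ⟩
    1ˢ · h        ≈⟨ ·-identityˡ h ⟩
    h             ∎
    where open ≗-Reasoning

  poch-sucʳ : ∀ a s N → poch a s (suc N) ≗ 1+q^ (a ℕ.+ s ℕ.* N) · poch a s N
  poch-sucʳ a s zero    = ·-cong (cong-app (cong 1+q^_ (sym (a+s*0≡a a s)))) (λ _ → refl)
  poch-sucʳ a s (suc N) = begin
    1+q^ a · poch (a ℕ.+ s) s (suc N)                ≈⟨ ·-congˡ (1+q^ a) (poch-sucʳ (a ℕ.+ s) s N) ⟩
    1+q^ a · (1+q^ (a ℕ.+ s ℕ.+ s ℕ.* N) · poch (a ℕ.+ s) s N)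
      ≈⟨ solve 3 (λ x y z → x :* (y :* z) := y :* (x :* z)) (λ _ → refl) (1+q^ a) _ _ ⟩
    1+q^ (a ℕ.+ s ℕ.+ s ℕ.* N) · poch a s (suc N)
      ≈⟨ ·-cong (cong-app (cong 1+q^_ (sym (a+s*[1+N]≡a+s+s*N a s N)))) (λ _ → refl) ⟩
    1+q^ (a ℕ.+ s ℕ.* suc N) · poch a s (suc N)      ∎
    where open ≗-Reasoning

  poch-split : ∀ a s N → poch a s (N ℕ.* 2) ≗ poch a (s ℕ.+ s) N · poch (a ℕ.+ s) (s ℕ.+ s) N
  poch-split a s zero    = λ n → sym (·-identityˡ 1ˢ n)
  poch-split a s (suc N) = begin
    1+q^ a · (1+q^ (a ℕ.+ s) · poch (a ℕ.+ s ℕ.+ s) s (N ℕ.* 2))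
      ≈⟨ ·-congˡ (1+q^ a) (·-congˡ (1+q^ (a ℕ.+ s)) (poch-split (a ℕ.+ s ℕ.+ s) s N)) ⟩
    1+q^ a · (1+q^ (a ℕ.+ s) · (poch (a ℕ.+ s ℕ.+ s) (s ℕ.+ s) N · poch (a ℕ.+ s ℕ.+ s ℕ.+ s) (s ℕ.+ s) N))
      ≈⟨ solve 4 (λ x y z w → x :* (y :* (z :* w)) := (x :* z) :* (y :* w)) (λ _ → refl)
                 (1+q^ a) (1+q^ (a ℕ.+ s)) _ _ ⟩
    (1+q^ a · poch (a ℕ.+ s ℕ.+ s) (s ℕ.+ s) N) · (1+q^ (a ℕ.+ s) · poch (a ℕ.+ s ℕ.+ s ℕ.+ s) (s ℕ.+ s) N)
      ≈⟨ ·-cong (·-congˡ (1+q^ a) (reindex (ℕₚ.+-assoc a s s)))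
                (·-congˡ (1+q^ (a ℕ.+ s)) (reindex (ℕₚ.+-assoc (a ℕ.+ s) s s))) ⟩
    poch a (s ℕ.+ s) (suc N) · poch (a ℕ.+ s) (s ℕ.+ s) (suc N) ∎
    where
    open ≗-Reasoning
    reindex : ∀ {b c} → b ≡ c → poch b (s ℕ.+ s) N ≗ poch c (s ℕ.+ s) N
    reindex b≡c = cong-app (cong (λ b → poch b (s ℕ.+ s) N) b≡c)

  poch∞-split : ∀ a s .{{_ : NonZero s}} → poch∞ a s ≗ poch∞ a (s ℕ.+ s) · poch∞ (a ℕ.+ s) (s ℕ.+ s)
  poch∞-split a s@(suc _) = ∀≗[]⇒≗ λ d →
    ≗[]-trans (poch∞-approx a s (suc d ℕ.* 2) (<⇒<+* a s (ℕₚ.m≤m*n (suc d) 2)))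
    (≗[]-trans (≗⇒≗[] (poch-split a s (suc d)))
               (≗[]-sym (·-cong≤ (poch∞-approx a (s ℕ.+ s) (suc d) (<⇒<+* a (s ℕ.+ s) ℕₚ.≤-refl))
                                 (poch∞-approx (a ℕ.+ s) (s ℕ.+ s) (suc d)
                                               (<⇒<+* (a ℕ.+ s) (s ℕ.+ s) ℕₚ.≤-refl)))))

  Σ< : ℕ → (ℕ → Series) → Series
  Σ< zero    T n = 0#
  Σ< (suc B) T n = Σ< B T n + T B n

  -- Only the terms j ≤ n + c of a c-summable family contribute to the coefficient of q^n.
  Summable : ℕ → (ℕ → Series) → Set
  Summable c T = ∀ j n → n ℕ.+ c < j → T j n ≡ 0#

  Σ∞ : ℕ → (ℕ → Series) → Series
  Σ∞ c T n = Σ< (suc (n ℕ.+ c)) T n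

  Σ<-cong : ∀ B {T U n m} → (∀ j → T j n ≡ U j m) → Σ< B T n ≡ Σ< B U m
  Σ<-cong zero    T≡U = refl
  Σ<-cong (suc B) T≡U = cong₂ _+_ (Σ<-cong B T≡U) (T≡U B)

  Σ<-zero : ∀ B {T n} → (∀ j → T j n ≡ 0#) → Σ< B T n ≡ 0#
  Σ<-zero zero    T≡0 = refl
  Σ<-zero (suc B) T≡0 = trans (cong₂ _+_ (Σ<-zero B T≡0) (T≡0 B)) (+-identityˡ 0#)

  Σ<-stable : ∀ {c T} → Summable c T → ∀ n B → suc (n ℕ.+ c) ≤ B → Σ< B T n ≡ Σ∞ c T n
  Σ<-stable {c} {T} summable n B n+c<B =
    trans (cong (λ B → Σ< B T n) (sym (ℕₚ.m+[n∸m]≡n n+c<B))) (extra (B ∸ suc (n ℕ.+ c)))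
    where
    m = suc (n ℕ.+ c)
    extra : ∀ k → Σ< (m ℕ.+ k) T n ≡ Σ∞ c T n
    extra zero    = cong (λ B → Σ< B T n) (ℕₚ.+-identityʳ m)
    extra (suc k) = begin
      Σ< (m ℕ.+ suc k) T n             ≡⟨ cong (λ B → Σ< B T n) (ℕₚ.+-suc m k) ⟩
      Σ< (m ℕ.+ k) T n + T (m ℕ.+ k) n ≡⟨ cong (Σ< (m ℕ.+ k) T n +_) (summable (m ℕ.+ k) n (ℕₚ.m≤m+n m k)) ⟩
      Σ< (m ℕ.+ k) T n + 0#            ≡⟨ +-identityʳ _ ⟩
      Σ< (m ℕ.+ k) T n                 ≡⟨ extra k ⟩
      Σ∞ c T n                         ∎
      where open ≡-Reasoning

  Σ∞-mono : ∀ {c c′ T} → c ≤ c′ → Summable c T → Σ∞ c T ≗ Σ∞ c′ T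
  Σ∞-mono c≤c′ summable n = sym (Σ<-stable summable n _ (s≤s (ℕₚ.+-monoʳ-≤ n c≤c′)))

  Σ∞-cong : ∀ {c T U} → (∀ j → T j ≗ U j) → Σ∞ c T ≗ Σ∞ c U
  Σ∞-cong {c} T≗U n = Σ<-cong (suc (n ℕ.+ c)) (λ j → T≗U j n)

  Σ∞-⊕ : ∀ c T U → Σ∞ c (λ j → T j ⊕ U j) ≗ Σ∞ c T ⊕ Σ∞ c U
  Σ∞-⊕ c T U n = Σ<-⊕ (suc (n ℕ.+ c))
    where
    Σ<-⊕ : ∀ B → Σ< B (λ j → T j ⊕ U j) n ≡ Σ< B T n + Σ< B U n
    Σ<-⊕ zero    = sym (+-identityˡ 0#)
    Σ<-⊕ (suc B) = trans (cong (_+ (T B n + U B n)) (Σ<-⊕ B)) (interchange _ _ _ _)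

  Σ∞-uncons : ∀ {c T} → Summable c T → Σ∞ c T ≗ T 0 ⊕ Σ∞ c (λ j → T (suc j))
  Σ∞-uncons {c} {T} summable n = begin
    Σ< (suc (n ℕ.+ c)) T n                                  ≡⟨ Σ<-uncons (n ℕ.+ c) ⟩
    T 0 n + Σ< (n ℕ.+ c) (λ j → T (suc j)) n               ≡⟨ cong (T 0 n +_) (+-identityʳ _) ⟨
    T 0 n + (Σ< (n ℕ.+ c) (λ j → T (suc j)) n + 0#)
      ≡⟨ cong (λ x → T 0 n + (Σ< (n ℕ.+ c) (λ j → T (suc j)) n + x)) (summable (suc (n ℕ.+ c)) n ℕₚ.≤-refl) ⟨
    T 0 n + Σ∞ c (λ j → T (suc j)) n                        ∎
    where
    open ≡-Reasoning
    Σ<-uncons : ∀ B → Σ< (suc B) T n ≡ T 0 n + Σ< B (λ j → T (suc j)) n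
    Σ<-uncons zero    = trans (+-identityˡ _) (sym (+-identityʳ _))
    Σ<-uncons (suc B) = trans (cong (_+ T (suc B) n) (Σ<-uncons B)) (+-assoc _ _ _)

  shift-Σ∞ : ∀ {c T} e → Summable c T → shift e (Σ∞ c T) ≗ Σ∞ c (λ j → shift e (T j))
  shift-Σ∞ {c} {T} e summable n with ℕₚ.<-≤-connex n e
  ... | inj₁ n<e = trans (shift-< e _ n<e) (sym (Σ<-zero (suc (n ℕ.+ c)) (λ j → shift-< e (T j) n<e)))
  ... | inj₂ e≤n = begin
    shift e (Σ∞ c T) n                      ≡⟨ shift-≥ e _ e≤n ⟩
    Σ∞ c T (n ∸ e)
      ≡⟨ Σ<-stable summable (n ∸ e) _ (s≤s (ℕₚ.+-monoˡ-≤ c (ℕₚ.m∸n≤m n e))) ⟨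
    Σ< (suc (n ℕ.+ c)) T (n ∸ e)            ≡⟨ Σ<-cong (suc (n ℕ.+ c)) (λ j → sym (shift-≥ e (T j) e≤n)) ⟩
    Σ∞ c (λ j → shift e (T j)) n            ∎
    where open ≡-Reasoning

  shifts-summable : ∀ c (e : ℕ → ℕ) (F : ℕ → Series) → (∀ j → j ≤ e j ℕ.+ c) →
                    Summable c (λ j → shift (e j) (F j))
  shifts-summable c e F j≤e+c j n n+c<j =
    shift-< (e j) (F j) (ℕₚ.+-cancelʳ-< c n (e j) (ℕₚ.<-≤-trans n+c<j (j≤e+c j)))

  f·g≗0ˢ⇒f≗0ˢ : ∀ {f g} → g 0 ≡ 1# → f · g ≗ 0ˢ → f ≗ 0ˢ
  f·g≗0ˢ⇒f≗0ˢ {f} {g} g₀≡1 fg≗0 = ∀≗[]⇒≗ vanishes-upto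
    where
    unit : ∀ n → f n ≡ f n * g 0
    unit n = trans (sym (*-identityʳ (f n))) (cong (f n *_) (sym g₀≡1))

    vanishes-upto : ∀ d → f ≗[ d ] 0ˢ
    vanishes-upto zero    zero    _ = trans (unit 0) (fg≗0 0)
    vanishes-upto (suc d) m m≤1+d with ℕₚ.m≤n⇒m<n∨m≡n m≤1+d
    ... | inj₁ (s≤s m≤d) = vanishes-upto d m m≤d
    ... | inj₂ refl      = begin
      f (suc d)                           ≡⟨ unit (suc d) ⟩
      f (suc d) * g 0                     ≡⟨ +-identityʳ _ ⟨
      f (suc d) * g 0 + 0#                ≡⟨ cong (f (suc d) * g 0 +_) (·-zeroˡ (tail g) d) ⟨
      f (suc d) * g 0 + (0ˢ · tail g) d
        ≡⟨ cong (f (suc d) * g 0 +_) (·-coeff-cong d (vanishes-upto d) (λ _ _ → refl)) ⟨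
      f (suc d) * g 0 + (f · tail g) d    ≡⟨ ·-tailʳ f g d ⟨
      (f · g) (suc d)                     ≡⟨ fg≗0 (suc d) ⟩
      0#                                  ∎
      where open ≡-Reasoning

  -- Strong induction on the degree n: the shifted term only involves degree n ∸ suc a < n,
  -- and iterating a ↦ a + s reaches the range n ≤ a, where Z and W agree by assumption.
  functional-equation-unique : ∀ s .{{_ : NonZero s}} (Z W : ℕ → Series) →
    (∀ a → Z (suc a) ≗ Z (suc a ℕ.+ s) ⊕ shift (suc a) (Z (suc a ℕ.+ s))) →
    (∀ a → W (suc a) ≗ W (suc a ℕ.+ s) ⊕ shift (suc a) (W (suc a ℕ.+ s))) →
    (∀ a → Z (suc a) ≗[ a ] W (suc a)) →
    ∀ a → Z (suc a) ≗ W (suc a)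
  functional-equation-unique s@(suc t) Z W Z-eq W-eq agree-low a n = <-rec P agree n a
    where
    P : ℕ → Set
    P n = ∀ a → Z (suc a) n ≡ W (suc a) n

    agree : ∀ n → (∀ {m} → m < n → P m) → P n
    agree n ih a = go n a (ℕₚ.m≤n+m n a)
      where
      go : ∀ k a → n ≤ a ℕ.+ k → Z (suc a) n ≡ W (suc a) n
      go k a n≤a+k with ℕₚ.≤-<-connex n a
      ... | inj₁ n≤a = agree-low a n n≤a
      go zero    a n≤a+0   | inj₂ a<n = contradiction (ℕₚ.≤-trans n≤a+0 (ℕₚ.≤-reflexive (ℕₚ.+-identityʳ a))) (ℕₚ.<⇒≱ a<n)
      go (suc k) a n≤a+1+k | inj₂ a<n = begin
        Z (suc a) n                                                 ≡⟨ Z-eq a n ⟩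
        Z (suc (a ℕ.+ s)) n + shift (suc a) (Z (suc (a ℕ.+ s))) n
          ≡⟨ cong₂ _+_ (go k (a ℕ.+ s) n≤a+s+k) shifted ⟩
        W (suc (a ℕ.+ s)) n + shift (suc a) (W (suc (a ℕ.+ s))) n   ≡⟨ W-eq a n ⟨
        W (suc a) n                                                 ∎
        where
        open ≡-Reasoning
        reorder : ∀ a k s → s ℕ.+ (a ℕ.+ k) ≡ a ℕ.+ s ℕ.+ k
        reorder = solve-∀
        n≤a+s+k : n ≤ a ℕ.+ s ℕ.+ k
        n≤a+s+k = ℕₚ.≤-trans n≤a+1+k (subst₂ _≤_ (sym (ℕₚ.+-suc a k)) (reorder a k s)
                                          (ℕₚ.+-monoˡ-≤ (a ℕ.+ k) (s≤s (z≤n {t}))))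
        shifted : shift (suc a) (Z (suc (a ℕ.+ s))) n ≡ shift (suc a) (W (suc (a ℕ.+ s))) n
        shifted = trans (shift-≥ (suc a) _ a<n)
          (trans (ih (ℕₚ.∸-monoʳ-< ℕ.z<s a<n) (a ℕ.+ s)) (sym (shift-≥ (suc a) _ a<n)))

open import Data.Nat using (_+_; _*_)

module NatSeries where

  open PowerSeries ℕₚ.+-*-isCommutativeSemiring public

  ·-as-sum : ∀ f g n → (f · g) n ≡ sum (map (λ i → f i * g (n ∸ i)) (upTo (suc n)))
  ·-as-sum f g n = trans (·-as-applyUpTo f g n) (cong sum (sym (map-upTo _ (suc n))))
    where
    ·-as-applyUpTo : ∀ f g n → (f · g) n ≡ sum (applyUpTo (λ i → f i * g (n ∸ i)) (suc n))
    ·-as-applyUpTo f g zero    = sym (ℕₚ.+-identityʳ _)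
    ·-as-applyUpTo f g (suc n) = cong (f 0 * g (suc n) +_) (·-as-applyUpTo (tail f) g n)

  T₂≡cube-pod : ∀ n → T₂ n ≡ cube pod n
  T₂≡cube-pod n = begin
    T₂ n
      ≡⟨ cong sum (map-cong inner (upTo (suc n))) ⟩
    sum (map (λ a → pod a * (pod · pod) (n ∸ a)) (upTo (suc n))) ≡⟨ ·-as-sum pod (pod · pod) n ⟨
    cube pod n                                                    ∎
    where
    open ≡-Reasoning
    inner : ∀ a → sum (map (λ b → pod a * pod b * pod (n ∸ a ∸ b)) (upTo (suc (n ∸ a))))
                ≡ pod a * (pod · pod) (n ∸ a)
    inner a = trans (sym (·-as-sum (pod a ⊙ pod) pod (n ∸ a))) (⊙-· (pod a) pod pod (n ∸ a))

  cube-suc : ∀ f n → ∃ λ k → cube f (suc n) ≡ shift 3 (cube (tail f)) (suc n) + 3 * k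
  cube-suc f n = m (suc n) , (begin
    cube f (suc n)                                       ≡⟨ ·-cong split (·-cong split split) (suc n) ⟩
    cube (const (f 0) ⊕ shift 1 (tail f)) (suc n)        ≡⟨ cube-⊕ (const (f 0)) (shift 1 (tail f)) (suc n) ⟩
    cube (const (f 0)) (suc n) + cube (shift 1 (tail f)) (suc n) + (m (suc n) + m (suc n) + m (suc n))
      ≡⟨ cong₂ (λ x y → x + y + (m (suc n) + m (suc n) + m (suc n)))
               (cube-const (f 0) (suc n)) (cube-shift 1 (tail f) (suc n)) ⟩
    0 + shift 3 (cube (tail f)) (suc n) + (m (suc n) + m (suc n) + m (suc n))
      ≡⟨ three-fold (shift 3 (cube (tail f)) (suc n)) (m (suc n)) ⟩
    shift 3 (cube (tail f)) (suc n) + 3 * m (suc n) ∎)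
    where
    open ≡-Reasoning
    split = const⊕shift-tail f
    m = const (f 0) · (const (f 0) · shift 1 (tail f)) ⊕ const (f 0) · (shift 1 (tail f) · shift 1 (tail f))
    three-fold : ∀ x y → 0 + x + (y + y + y) ≡ x + 3 * y
    three-fold = solve-∀

  3∣cube[1+3k] : ∀ f k → 3 ∣ cube f (suc (k * 3))
  3∣cube[1+3k] f zero    = let (m , eq) = cube-suc f 0 in divides m (trans eq (ℕₚ.*-comm 3 m))
  3∣cube[1+3k] f (suc k) = let (m , eq) = cube-suc f (suc k * 3) in
    subst (3 ∣_) (sym eq) (∣m∣n⇒∣m+n (3∣cube[1+3k] (tail f) k) (m∣m*n m))

  3∣T₂[1+3k] : ∀ k → 3 ∣ T₂ (suc (k * 3))
  3∣T₂[1+3k] k = subst (3 ∣_) (sym (T₂≡cube-pod (suc (k * 3)))) (3∣cube[1+3k] pod k)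

  oddParts : ℕ → Series
  oddParts k m = oddPartsAux k m m

  oddPartsAux-zero : ∀ k f → oddPartsAux k 0 f ≡ 1
  oddPartsAux-zero zero    f       = refl
  oddPartsAux-zero (suc k) zero    = refl
  oddPartsAux-zero (suc k) (suc f) with suc k % 2 ≡ᵇ 1
  ... | true  = trans (ℕₚ.+-identityʳ _) (oddPartsAux-zero k (suc f))
  ... | false = trans (ℕₚ.+-identityʳ _) (oddPartsAux-zero k (suc f))

  oddPartsAux-fuel : ∀ k m {f f′} → m ≤ f → m ≤ f′ → oddPartsAux k m f ≡ oddPartsAux k m f′
  oddPartsAux-fuel zero    zero    _ _ = refl
  oddPartsAux-fuel zero    (suc m) _ _ = refl
  oddPartsAux-fuel (suc k) m {zero}  {zero}   _   _   = refl
  oddPartsAux-fuel (suc k) m {zero}  {suc f′} z≤n _   = sym (oddPartsAux-zero (suc k) (suc f′))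
  oddPartsAux-fuel (suc k) m {suc f} {zero}   _   z≤n = oddPartsAux-zero (suc k) (suc f)
  oddPartsAux-fuel (suc k) m {suc f} {suc f′} m≤f m≤f′ with suc k % 2 ≡ᵇ 1
  ... | false = cong (_+ 0) (oddPartsAux-fuel k m m≤f m≤f′)
  ... | true with m <ᵇ suc k | <ᵇ-reflects-< m (suc k)
  ...   | true  | _        = cong (_+ 0) (oddPartsAux-fuel k m m≤f m≤f′)
  ...   | false | ofⁿ m≮k = cong₂ _+_ (oddPartsAux-fuel k m m≤f m≤f′)
                                        (oddPartsAux-fuel (suc k) (m ∸ suc k) (remaining m≤f) (remaining m≤f′))
    where
    remaining : ∀ {g} → m ≤ suc g → m ∸ suc k ≤ g
    remaining {g} m≤g = ℕₚ.≤-trans (ℕₚ.∸-monoˡ-≤ (suc k) m≤g) (ℕₚ.m∸n≤m g k)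

  oddPartsAux-bound : ∀ k m f → m ≤ k → oddPartsAux (suc k) m f ≡ oddPartsAux k m f
  oddPartsAux-bound zero    .0 zero    z≤n = refl
  oddPartsAux-bound (suc k) m  zero    _   = refl
  oddPartsAux-bound k       m  (suc f) m≤k with suc k % 2 ≡ᵇ 1
  ... | false = ℕₚ.+-identityʳ _
  ... | true with m <ᵇ suc k | <ᵇ-reflects-< m (suc k)
  ...   | true  | _        = ℕₚ.+-identityʳ _
  ...   | false | ofⁿ m≮k = contradiction (s≤s m≤k) m≮k

  oddParts≡pod : ∀ {k m} → m ≤ k → oddParts k m ≡ pod m
  oddParts≡pod {k} {m} m≤k = trans (cong (λ k → oddParts k m) (sym (ℕₚ.m+[n∸m]≡n m≤k))) (drop (k ∸ m))
    where
    drop : ∀ j → oddParts (m + j) m ≡ pod m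
    drop zero    = cong (λ k → oddParts k m) (ℕₚ.+-identityʳ m)
    drop (suc j) = trans (cong (λ k → oddParts k m) (ℕₚ.+-suc m j))
                         (trans (oddPartsAux-bound (m + j) m m (ℕₚ.m≤m+n m j)) (drop j))

  oddParts-suc : ∀ k → oddParts (suc k) ≗
                 oddParts k ⊕ (if suc k % 2 ≡ᵇ 1 then shift (suc k) (oddParts (suc k)) else 0ˢ)
  oddParts-suc k zero    = sym (cong₂ _+_ (oddPartsAux-zero k 0) (vanishes (suc k % 2 ≡ᵇ 1)))
    where
    vanishes : ∀ b → (if b then shift (suc k) (oddParts (suc k)) else 0ˢ) 0 ≡ 0
    vanishes false = refl
    vanishes true  = refl
  oddParts-suc k (suc m) = cong (oddParts k (suc m) +_) (largest-part (suc k % 2 ≡ᵇ 1))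
    where
    largest-part : ∀ b → (if b then (if suc m <ᵇ suc k then 0 else oddPartsAux (suc k) (m ∸ k) m) else 0)
                         ≡ (if b then shift (suc k) (oddParts (suc k)) else 0ˢ) (suc m)
    largest-part false = refl
    largest-part true with suc m <ᵇ suc k | <ᵇ-reflects-< (suc m) (suc k)
    ... | true  | ofʸ m<k  = sym (shift-< (suc k) (oddParts (suc k)) m<k)
    ... | false | ofⁿ m≮k = trans (oddPartsAux-fuel (suc k) (m ∸ k) (ℕₚ.m∸n≤m m k) ℕₚ.≤-refl)
                                  (sym (shift-≥ (suc k) (oddParts (suc k)) (ℕₚ.≮⇒≥ m≮k)))

  oddParts-odd : ∀ N → let k = suc (N * 2) in oddParts k ≗ oddParts (N * 2) ⊕ shift k (oddParts k)
  oddParts-odd N n = trans (oddParts-suc (N * 2) n)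
    (cong (λ b → oddParts (N * 2) n + (if b ≡ᵇ 1 then shift k (oddParts k) else 0ˢ) n) ([m+kn]%n≡m%n 1 N 2))
    where k = suc (N * 2)

  oddParts-even : ∀ N → oddParts (suc N * 2) ≗ oddParts (suc (N * 2))
  oddParts-even N n = trans (oddParts-suc (suc (N * 2)) n)
    (trans (cong (λ b → oddParts (suc (N * 2)) n + (if b ≡ᵇ 1 then shift k (oddParts k) else 0ˢ) n)
                 ([m+kn]%n≡m%n 0 (suc N) 2))
           (ℕₚ.+-identityʳ _))
    where k = suc N * 2

module SeriesHomomorphism
  {A B : Set} {_+ᴬ_ _*ᴬ_ : Op₂ A} {0ᴬ 1ᴬ : A} {_+ᴮ_ _*ᴮ_ : Op₂ B} {0ᴮ 1ᴮ : B}
  (isA : IsCommutativeSemiring _≡_ _+ᴬ_ _*ᴬ_ 0ᴬ 1ᴬ) (isB : IsCommutativeSemiring _≡_ _+ᴮ_ _*ᴮ_ 0ᴮ 1ᴮ)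
  (φ : A → B)
  (φ-+ : ∀ x y → φ (x +ᴬ y) ≡ φ x +ᴮ φ y)
  (φ-* : ∀ x y → φ (x *ᴬ y) ≡ φ x *ᴮ φ y)
  (φ-0 : φ 0ᴬ ≡ 0ᴮ)
  where

  private
    module S = PowerSeries isA
    module T = PowerSeries isB

  map-⊕ : ∀ f g → φ ∘ (f S.⊕ g) ≗ (φ ∘ f) T.⊕ (φ ∘ g)
  map-⊕ f g n = φ-+ (f n) (g n)

  map-shift : ∀ e f → φ ∘ S.shift e f ≗ T.shift e (φ ∘ f)
  map-shift zero    f n       = refl
  map-shift (suc e) f zero    = φ-0
  map-shift (suc e) f (suc n) = map-shift e f n

  map-· : ∀ f g → φ ∘ (f S.· g) ≗ (φ ∘ f) T.· (φ ∘ g)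
  map-· f g zero    = φ-* (f 0) (g 0)
  map-· f g (suc n) = trans (φ-+ _ _) (cong₂ _+ᴮ_ (φ-* _ _) (map-· (S.tail f) g n))

parity : ℕ → Bool
parity zero    = false
parity (suc n) = not (parity n)

parity-+ : ∀ m n → parity (m + n) ≡ parity m xor parity n
parity-+ zero    n = refl
parity-+ (suc m) n = trans (cong not (parity-+ m n)) (not-distribˡ-xor (parity m) (parity n))

parity-* : ∀ m n → parity (m * n) ≡ parity m ∧ parity n
parity-* zero    n = refl
parity-* (suc m) n = trans (parity-+ n (m * n)) (trans (cong (parity n xor_) (parity-* m n)) (absorb (parity m)))
  where
  absorb : ∀ a → parity n xor (a ∧ parity n) ≡ not a ∧ parity n
  absorb false = xor-identityʳ (parity n)
  absorb true  = xor-same (parity n)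

parity≡false⇒2∣ : ∀ n → parity n ≡ false → 2 ∣ n
parity≡false⇒2∣ zero          _  = divides 0 refl
parity≡false⇒2∣ (suc (suc n)) eq =
  ∣m∣n⇒∣m+n (∣-refl {2}) (parity≡false⇒2∣ n (trans (sym (not-involutive (parity n))) eq))

𝔽₂ : CommutativeRing 0ℓ 0ℓ
𝔽₂ = xor-∧-commutativeRing

module 𝔽₂Series where

  open PowerSeries (CommutativeRing.isCommutativeSemiring 𝔽₂) public
  open Solver using (solve; _:*_; _:=_)

  ⊕-self : ∀ f → f ⊕ f ≗ 0ˢ
  ⊕-self f n = xor-same (f n)

  ⊕-cancelʳ : ∀ f g → (f ⊕ g) ⊕ g ≗ f
  ⊕-cancelʳ f g n = trans (xor-assoc (f n) (g n) (g n)) (trans (cong (f n xor_) (xor-same (g n))) (xor-identityʳ (f n)))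

  ⊕-cancel-middle : ∀ f g h → (f ⊕ g) ⊕ (g ⊕ h) ≗ f ⊕ h
  ⊕-cancel-middle f g h n = trans (xor-assoc (f n) (g n) (g n xor h n))
    (cong (f n xor_) (trans (sym (xor-assoc (g n) (g n) (h n))) (cong (_xor h n) (xor-same (g n)))))

  ⊕≗0ˢ⇒≗ : ∀ {f g} → f ⊕ g ≗ 0ˢ → f ≗ g
  ⊕≗0ˢ⇒≗ {f} {g} f⊕g≗0 n = xor≡false⇒≡ (f n) (g n) (f⊕g≗0 n)
    where
    xor≡false⇒≡ : ∀ x y → x xor y ≡ false → x ≡ y
    xor≡false⇒≡ false false _ = refl
    xor≡false⇒≡ true  true  _ = refl

  1+q^-square : ∀ a → 1+q^ a · 1+q^ a ≗ 1+q^ (a + a)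
  1+q^-square a n = begin
    (1+q^ a · 1+q^ a) n                                          ≡⟨ 1+q^-· a (1+q^ a) n ⟩
    (1+q^ a ⊕ shift a (1+q^ a)) n
      ≡⟨ cong ((1+q^ a) n xor_) (shift-⊕ a 1ˢ (shift a 1ˢ) n) ⟩
    ((1ˢ ⊕ shift a 1ˢ) ⊕ (shift a 1ˢ ⊕ shift a (shift a 1ˢ))) n
      ≡⟨ ⊕-cancel-middle 1ˢ (shift a 1ˢ) (shift a (shift a 1ˢ)) n ⟩
    (1ˢ ⊕ shift a (shift a 1ˢ)) n                                ≡⟨ cong (1ˢ n xor_) (shift-shift a a 1ˢ n) ⟩
    (1+q^ (a + a)) n                                           ∎
    where open ≡-Reasoning

  poch-square : ∀ a s N → poch a s N · poch a s N ≗ poch (a + a) (s + s) N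
  poch-square a s zero    = ·-identityˡ 1ˢ
  poch-square a s (suc N) = begin
    (1+q^ a · poch (a + s) s N) · (1+q^ a · poch (a + s) s N)
      ≈⟨ solve 2 (λ x y → (x :* y) :* (x :* y) := (x :* x) :* (y :* y)) (λ _ → refl) (1+q^ a) _ ⟩
    (1+q^ a · 1+q^ a) · (poch (a + s) s N · poch (a + s) s N)
      ≈⟨ ·-cong (1+q^-square a) (poch-square (a + s) s N) ⟩
    1+q^ (a + a) · poch (a + s + (a + s)) (s + s) N
      ≈⟨ ·-congˡ (1+q^ (a + a)) (cong-app (cong (λ b → poch b (s + s) N) (regroup a s))) ⟩
    poch (a + a) (s + s) (suc N) ∎
    where
    open ≗-Reasoning
    regroup : ∀ a s → a + s + (a + s) ≡ a + a + (s + s)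
    regroup = solve-∀

  poch∞-square : ∀ a s .{{_ : NonZero s}} → poch∞ a s · poch∞ a s ≗ poch∞ (a + a) (s + s)
  poch∞-square a s@(suc _) = ∀≗[]⇒≗ λ d →
    ≗[]-trans (·-cong≤ (approx a s d) (approx a s d))
    (≗[]-trans (≗⇒≗[] (poch-square a s (suc d))) (≗[]-sym (approx (a + a) (s + s) d)))
    where
    approx : ∀ a s d .{{_ : NonZero s}} → poch∞ a s ≗[ d ] poch a s (suc d)
    approx a s d = poch∞-approx a s (suc d) (<⇒<+* a s ℕₚ.≤-refl)

  Σ<≡true⇒∃ : ∀ B {T n} → Σ< B T n ≡ true → ∃ λ j → T j n ≡ true
  Σ<≡true⇒∃ zero    ()
  Σ<≡true⇒∃ (suc B) {T} {n} eq with T B n in TBn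
  ... | true  = B , TBn
  ... | false = Σ<≡true⇒∃ B (trans (sym (xor-identityʳ _)) eq)

  shift≡true : ∀ e f {n} → shift e f n ≡ true → e ≤ n × f (n ∸ e) ≡ true
  shift≡true e f {n} coeff≡true with ℕₚ.<-≤-connex n e
  ... | inj₁ n<e = contradiction (trans (sym (shift-< e f n<e)) coeff≡true) λ ()
  ... | inj₂ e≤n = e≤n , trans (sym (shift-≥ e f e≤n)) coeff≡true

  poch∞≡true : ∀ {a k} s → k < a → poch∞ a s k ≡ true → k ≡ 0
  poch∞≡true {k = zero}  s _   _          = refl
  poch∞≡true {k = suc k} s k<a coeff≡true =
    contradiction (trans (sym (poch∞-≗[]1ˢ s k<a (suc k) ℕₚ.≤-refl)) coeff≡true) λ ()

module PodParity where

  open 𝔽₂Series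
  open Solver using (solve; _:*_; _:=_)
  open NatSeries using (oddParts; oddParts-odd; oddParts-even; oddParts≡pod)
  module Parity = SeriesHomomorphism ℕₚ.+-*-isCommutativeSemiring (CommutativeRing.isCommutativeSemiring 𝔽₂)
                                     parity parity-+ parity-* refl

  podParity : Series
  podParity = parity ∘ pod

  oddPartsParity : ℕ → Series
  oddPartsParity k = parity ∘ oddParts k

  1+q^·oddPartsParity : ∀ N → let k = suc (N * 2) in 1+q^ k · oddPartsParity k ≗ oddPartsParity (N * 2)
  1+q^·oddPartsParity N = begin
    1+q^ k · oddPartsParity k
      ≈⟨ 1+q^-· k (oddPartsParity k) ⟩
    oddPartsParity k ⊕ shift k (oddPartsParity k)
      ≈⟨ ⊕-cong largest-part (λ _ → refl) ⟩
    oddPartsParity (N * 2) ⊕ shift k (oddPartsParity k) ⊕ shift k (oddPartsParity k)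
      ≈⟨ ⊕-cancelʳ (oddPartsParity (N * 2)) (shift k (oddPartsParity k)) ⟩
    oddPartsParity (N * 2) ∎
    where
    open ≗-Reasoning
    k = suc (N * 2)
    largest-part : oddPartsParity k ≗ oddPartsParity (N * 2) ⊕ shift k (oddPartsParity k)
    largest-part n = trans (cong parity (oddParts-odd N n))
      (trans (Parity.map-⊕ (oddParts (N * 2)) (NatSeries.shift k (oddParts k)) n)
             (cong (oddPartsParity (N * 2) n xor_) (Parity.map-shift k (oddParts k) n)))

  poch-1-2·oddPartsParity : ∀ N → poch 1 2 N · oddPartsParity (N * 2) ≗ 1ˢ
  poch-1-2·oddPartsParity zero    n = trans (·-identityˡ (oddPartsParity 0) n) (no-parts n)
    where
    no-parts : oddPartsParity 0 ≗ 1ˢ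
    no-parts zero    = refl
    no-parts (suc n) = refl
  poch-1-2·oddPartsParity (suc N) = begin
    poch 1 2 (suc N) · oddPartsParity (suc N * 2)
      ≈⟨ ·-cong (poch-sucʳ 1 2 N) (λ n → cong parity (oddParts-even N n)) ⟩
    1+q^ (1 + 2 * N) · poch 1 2 N · oddPartsParity k
      ≈⟨ ·-cong (·-cong (cong-app (cong 1+q^_ (cong suc (ℕₚ.*-comm 2 N)))) (λ _ → refl)) (λ _ → refl) ⟩
    1+q^ k · poch 1 2 N · oddPartsParity k
      ≈⟨ solve 3 (λ x y z → (x :* y) :* z := y :* (x :* z)) (λ _ → refl) (1+q^ k) (poch 1 2 N) _ ⟩
    poch 1 2 N · (1+q^ k · oddPartsParity k)
      ≈⟨ ·-congˡ (poch 1 2 N) (1+q^·oddPartsParity N) ⟩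
    poch 1 2 N · oddPartsParity (N * 2)
      ≈⟨ poch-1-2·oddPartsParity N ⟩
    1ˢ ∎
    where
    open ≗-Reasoning
    k = suc (N * 2)

  poch∞-1-2·podParity : poch∞ 1 2 · podParity ≗ 1ˢ
  poch∞-1-2·podParity = ∀≗[]⇒≗ λ d →
    ≗[]-trans (·-cong≤ (poch∞-approx 1 2 (suc d) (<⇒<+* 1 2 ℕₚ.≤-refl))
                       (podParity≗[]oddPartsParity (ℕₚ.≤-trans (ℕₚ.n≤1+n d) (ℕₚ.m≤m*n (suc d) 2))))
              (≗⇒≗[] (poch-1-2·oddPartsParity (suc d)))
    where
    podParity≗[]oddPartsParity : ∀ {d k} → d ≤ k → podParity ≗[ d ] oddPartsParity k
    podParity≗[]oddPartsParity d≤k m m≤d = cong parity (sym (oddParts≡pod (ℕₚ.≤-trans m≤d d≤k)))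

  poch∞-1-2·poch∞-1-1 : poch∞ 1 2 · poch∞ 1 1 ≗ 1ˢ
  poch∞-1-2·poch∞-1-1 = ⊕≗0ˢ⇒≗ (f·g≗0ˢ⇒f≗0ˢ refl (begin
    (O · D ⊕ 1ˢ) · D     ≈⟨ ·-distribʳ (O · D) 1ˢ D ⟩
    O · D · D ⊕ 1ˢ · D   ≈⟨ ⊕-cong (·-assoc O D D) (·-identityˡ D) ⟩
    O · (D · D) ⊕ D      ≈⟨ ⊕-cong (λ n → sym (D≗O·D² n)) (λ _ → refl) ⟩
    D ⊕ D                ≈⟨ ⊕-self D ⟩
    0ˢ                   ∎))
    where
    open ≗-Reasoning
    O = poch∞ 1 2
    D = poch∞ 1 1
    D≗O·D² : D ≗ O · (D · D)
    D≗O·D² n = trans (poch∞-split 1 1 n) (·-congˡ O (≗-sym (poch∞-square 1 1)) n)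

  podParity≗poch∞-1-1 : podParity ≗ poch∞ 1 1
  podParity≗poch∞-1-1 = inverse-unique poch∞-1-2·podParity poch∞-1-2·poch∞-1-1

  cube-poch∞-1-1 : cube (poch∞ 1 1) ≗ poch∞ 1 4 · (poch∞ 4 4 · poch∞ 3 4)
  cube-poch∞-1-1 = begin
    D · (D · D)
      ≈⟨ ·-identityˡ (D · (D · D)) ⟨
    1ˢ · (D · (D · D))
      ≈⟨ ·-cong poch∞-1-2·poch∞-1-1 (λ _ → refl) ⟨
    (O · D) · (D · (D · D))
      ≈⟨ solve 2 (λ o d → (o :* d) :* (d :* (d :* d)) := o :* ((d :* d) :* (d :* d))) (λ _ → refl) O D ⟩
    O · ((D · D) · (D · D))
      ≈⟨ ·-cong (poch∞-split 1 2) (·-cong (poch∞-square 1 1) (poch∞-square 1 1)) ⟩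
    (poch∞ 1 4 · poch∞ 3 4) · (poch∞ 2 2 · poch∞ 2 2)
      ≈⟨ ·-congˡ (poch∞ 1 4 · poch∞ 3 4) (poch∞-square 2 2) ⟩
    (poch∞ 1 4 · poch∞ 3 4) · poch∞ 4 4
      ≈⟨ solve 3 (λ x y z → (x :* y) :* z := x :* (z :* y)) (λ _ → refl) (poch∞ 1 4) (poch∞ 3 4) (poch∞ 4 4) ⟩
    poch∞ 1 4 · (poch∞ 4 4 · poch∞ 3 4) ∎
    where
    open ≗-Reasoning
    O = poch∞ 1 2
    D = poch∞ 1 1

module EulerExpansion where

  open 𝔽₂Series

  Q : ℕ → Series
  Q j = poch∞ (4 * suc j) 4

  Q-suc : ∀ j → Q j ≗ Q (suc j) ⊕ shift (4 * suc j) (Q (suc j))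
  Q-suc j n = trans (poch∞-suc (4 * suc j) 4 n)
    (trans (·-congˡ (1+q^ (4 * suc j)) (cong-app (cong (λ a → poch∞ a 4) (next j))) n)
           (1+q^-· (4 * suc j) (Q (suc j)) n))
    where
    next : ∀ j → 4 * suc j + 4 ≡ 4 * suc (suc j)
    next = solve-∀

  eulerExp : ℕ → ℕ → ℕ
  eulerExp a zero    = 0
  eulerExp a (suc j) = eulerExp a j + (a + 4 * j)

  eulerExp-+4 : ∀ a j → eulerExp (a + 4) j ≡ eulerExp a j + 4 * j
  eulerExp-+4 a zero    = refl
  eulerExp-+4 a (suc j) = trans (cong (_+ (a + 4 + 4 * j)) (eulerExp-+4 a j)) (regroup (eulerExp a j) a j)
    where
    regroup : ∀ x a j → x + 4 * j + (a + 4 + 4 * j) ≡ x + (a + 4 * j) + 4 * suc j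
    regroup = solve-∀

  eulerExp-suc : ∀ a j → eulerExp a (suc j) ≡ a + eulerExp (a + 4) j
  eulerExp-suc a j = trans (regroup (eulerExp a j) a j) (cong (a +_) (sym (eulerExp-+4 a j)))
    where
    regroup : ∀ x a j → x + (a + 4 * j) ≡ a + (x + 4 * j)
    regroup = solve-∀

  j≤eulerExp : ∀ a j → j ≤ eulerExp (suc a) j
  j≤eulerExp a zero    = z≤n
  j≤eulerExp a (suc j) = subst (_≤ eulerExp (suc a) (suc j)) (ℕₚ.+-comm j 1)
                               (ℕₚ.+-mono-≤ (j≤eulerExp a j) (s≤s z≤n))

  a≤eulerExp : ∀ a j → a ≤ eulerExp a (suc j)
  a≤eulerExp a j = ℕₚ.≤-trans (ℕₚ.m≤m+n a (4 * j)) (ℕₚ.m≤n+m _ (eulerExp a j))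

  eulerTerm : ℕ → ℕ → Series
  eulerTerm a j = shift (eulerExp a j) (Q j)

  eulerSum : ℕ → Series
  eulerSum a = Σ∞ 0 (eulerTerm a)

  eulerProduct : ℕ → Series
  eulerProduct a = poch∞ a 4 · Q 0

  eulerTerm-summable : ∀ a → Summable 0 (eulerTerm (suc a))
  eulerTerm-summable a = shifts-summable 0 (eulerExp (suc a)) Q
    (λ j → ℕₚ.≤-trans (j≤eulerExp a j) (ℕₚ.m≤m+n _ 0))

  eulerTerm-suc : ∀ a j → eulerTerm a (suc j) ⊕ eulerTerm (a + 4) (suc j) ≗ shift a (eulerTerm (a + 4) j)
  eulerTerm-suc a j = begin
    shift e (Q (suc j)) ⊕ shift (eulerExp (a + 4) (suc j)) (Q (suc j))
      ≈⟨ ⊕-congˡ (shift e (Q (suc j))) (λ n → cong (λ e → shift e (Q (suc j)) n) (eulerExp-+4 a (suc j))) ⟩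
    shift e (Q (suc j)) ⊕ shift (e + 4 * suc j) (Q (suc j))
      ≈⟨ ⊕-congˡ (shift e (Q (suc j))) (shift-shift e (4 * suc j) (Q (suc j))) ⟨
    shift e (Q (suc j)) ⊕ shift e (shift (4 * suc j) (Q (suc j)))
      ≈⟨ shift-⊕ e (Q (suc j)) _ ⟨
    shift e (Q (suc j) ⊕ shift (4 * suc j) (Q (suc j)))
      ≈⟨ shift-cong e (Q-suc j) ⟨
    shift e (Q j)
      ≈⟨ (λ n → cong (λ e → shift e (Q j) n) (eulerExp-suc a j)) ⟩
    shift (a + eulerExp (a + 4) j) (Q j)
      ≈⟨ shift-shift a (eulerExp (a + 4) j) (Q j) ⟨
    shift a (eulerTerm (a + 4) j) ∎
    where
    open ≗-Reasoning
    e = eulerExp a (suc j)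

  eulerSum-functional : ∀ a → eulerSum (suc a) ≗ eulerSum (suc a + 4) ⊕ shift (suc a) (eulerSum (suc a + 4))
  eulerSum-functional a = ≗-sym (begin
    Σ∞ 0 E′ ⊕ shift b (Σ∞ 0 E′)
      ≈⟨ ⊕-cong (Σ∞-uncons (eulerTerm-summable (a + 4))) (shift-Σ∞ b (eulerTerm-summable (a + 4))) ⟩
    (Q 0 ⊕ Σ∞ 0 (E′ ∘ suc)) ⊕ Σ∞ 0 (λ j → shift b (E′ j))
      ≈⟨ ⊕-congˡ H (Σ∞-cong (λ j → ≗-sym (eulerTerm-suc b j))) ⟩
    (Q 0 ⊕ Σ∞ 0 (E′ ∘ suc)) ⊕ Σ∞ 0 (λ j → E (suc j) ⊕ E′ (suc j))
      ≈⟨ ⊕-congˡ H (Σ∞-⊕ 0 (E ∘ suc) (E′ ∘ suc)) ⟩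
    (Q 0 ⊕ Σ∞ 0 (E′ ∘ suc)) ⊕ (Σ∞ 0 (E ∘ suc) ⊕ Σ∞ 0 (E′ ∘ suc))
      ≈⟨ ⊕-congˡ H (⊕-comm (Σ∞ 0 (E ∘ suc)) (Σ∞ 0 (E′ ∘ suc))) ⟩
    (Q 0 ⊕ Σ∞ 0 (E′ ∘ suc)) ⊕ (Σ∞ 0 (E′ ∘ suc) ⊕ Σ∞ 0 (E ∘ suc))
      ≈⟨ ⊕-cancel-middle (Q 0) (Σ∞ 0 (E′ ∘ suc)) (Σ∞ 0 (E ∘ suc)) ⟩
    Q 0 ⊕ Σ∞ 0 (E ∘ suc)
      ≈⟨ Σ∞-uncons (eulerTerm-summable a) ⟨
    Σ∞ 0 E ∎)
    where
    open ≗-Reasoning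
    b = suc a
    E = eulerTerm b
    E′ = eulerTerm (b + 4)
    H = Q 0 ⊕ Σ∞ 0 (E′ ∘ suc)

  eulerProduct-functional : ∀ a →
    eulerProduct (suc a) ≗ eulerProduct (suc a + 4) ⊕ shift (suc a) (eulerProduct (suc a + 4))
  eulerProduct-functional a = begin
    poch∞ (suc a) 4 · Q 0                      ≈⟨ ·-cong (poch∞-suc (suc a) 4) (λ _ → refl) ⟩
    1+q^ (suc a) · poch∞ (suc a + 4) 4 · Q 0   ≈⟨ ·-assoc (1+q^ (suc a)) _ (Q 0) ⟩
    1+q^ (suc a) · eulerProduct (suc a + 4)    ≈⟨ 1+q^-· (suc a) _ ⟩
    eulerProduct (suc a + 4) ⊕ shift (suc a) (eulerProduct (suc a + 4)) ∎
    where open ≗-Reasoning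

  eulerProduct-low : ∀ a → eulerProduct (suc a) ≗[ a ] Q 0
  eulerProduct-low a = ≗[]-trans (·-cong≤ (poch∞-≗[]1ˢ 4 ℕₚ.≤-refl) ≗[]-refl) (≗⇒≗[] (·-identityˡ (Q 0)))

  eulerSum-low : ∀ a → eulerSum (suc a) ≗[ a ] Q 0
  eulerSum-low a n n≤a = trans (Σ∞-uncons (eulerTerm-summable a) n)
    (trans (cong (Q 0 n xor_) (Σ<-zero (suc (n + 0)) λ j →
                 shift-< _ (Q (suc j)) (ℕₚ.≤-trans (s≤s n≤a) (a≤eulerExp (suc a) j))))
           (xor-identityʳ (Q 0 n)))

  -- Euler's (−q^a; q⁴)_∞ = Σ_j q^(eulerExp a j) / (q⁴; q⁴)_j, multiplied by (q⁴; q⁴)_∞ ≡ Q 0.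
  euler : ∀ a → eulerProduct (suc a) ≗ eulerSum (suc a)
  euler = functional-equation-unique 4 eulerProduct eulerSum eulerProduct-functional eulerSum-functional
            (λ a → ≗[]-trans (eulerProduct-low a) (≗[]-sym (eulerSum-low a)))

module GaussExpansion where

  open 𝔽₂Series
  open EulerExpansion using (Q; Q-suc; eulerExp; eulerProduct; eulerSum; euler)
  open Solver using (solve; _:*_; _:=_)

  -- gaussExp i M = m (2m + 1) for the integer m = M − i; these are the triangular numbers.
  gaussExp : ℕ → ℕ → ℕ
  gaussExp zero    M       = M * (2 * M + 1)
  gaussExp (suc i) zero    = suc i * (2 * i + 1)
  gaussExp (suc i) (suc M) = gaussExp i M

  gaussExp-suc : ∀ i M → gaussExp i M + 4 * suc i ≡ 3 + 4 * M + gaussExp (suc i) M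
  gaussExp-suc zero    zero    = refl
  gaussExp-suc zero    (suc M) = identity M
    where
    identity : ∀ M → suc M * (2 * suc M + 1) + 4 * 1 ≡ 3 + 4 * suc M + M * (2 * M + 1)
    identity = solve-∀
  gaussExp-suc (suc i) zero    = identity i
    where
    identity : ∀ i → suc i * (2 * i + 1) + 4 * suc (suc i) ≡ 3 + 4 * 0 + suc (suc i) * (2 * suc i + 1)
    identity = solve-∀
  gaussExp-suc (suc i) (suc M) =
    trans (regroup (gaussExp i M) i) (trans (cong (4 +_) (gaussExp-suc i M)) (regroup′ M (gaussExp (suc i) M)))
    where
    regroup : ∀ x i → x + 4 * suc (suc i) ≡ 4 + (x + 4 * suc i)
    regroup = solve-∀
    regroup′ : ∀ M y → 4 + (3 + 4 * M + y) ≡ 3 + 4 * suc M + y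
    regroup′ = solve-∀

  gaussExp-0-suc : ∀ M → gaussExp 0 (suc M) ≡ 3 + 4 * M + gaussExp 0 M
  gaussExp-0-suc = identity
    where
    identity : ∀ M → suc M * (2 * suc M + 1) ≡ 3 + 4 * M + M * (2 * M + 1)
    identity = solve-∀

  i≤gaussExp+M : ∀ i M → i ≤ gaussExp i M + M
  i≤gaussExp+M zero    M       = z≤n
  i≤gaussExp+M (suc i) zero    = subst (suc i ≤_) (identity i) (ℕₚ.m≤m+n (suc i) (suc i * (2 * i)))
    where
    identity : ∀ i → suc i + suc i * (2 * i) ≡ suc i * (2 * i + 1) + 0
    identity = solve-∀
  i≤gaussExp+M (suc i) (suc M) = subst (suc i ≤_) (sym (ℕₚ.+-suc (gaussExp i M) M)) (s≤s (i≤gaussExp+M i M))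

  M≤gaussExp+i : ∀ i M → M ≤ gaussExp i M + i
  M≤gaussExp+i zero    M       = subst (M ≤_) (identity M) (ℕₚ.m≤m+n M (M * (2 * M)))
    where
    identity : ∀ M → M + M * (2 * M) ≡ M * (2 * M + 1) + 0
    identity = solve-∀
  M≤gaussExp+i (suc i) zero    = z≤n
  M≤gaussExp+i (suc i) (suc M) = subst (suc M ≤_) (sym (ℕₚ.+-suc (gaussExp i M) i)) (s≤s (M≤gaussExp+i i M))

  gaussExp-i-0 : ∀ j → gaussExp j 0 ≡ eulerExp 1 j
  gaussExp-i-0 zero          = refl
  gaussExp-i-0 (suc zero)    = refl
  gaussExp-i-0 (suc (suc j)) = trans (identity j) (cong (_+ (1 + 4 * suc j)) (gaussExp-i-0 (suc j)))
    where
    identity : ∀ j → suc (suc j) * (2 * suc j + 1) ≡ suc j * (2 * j + 1) + (1 + 4 * suc j)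
    identity = solve-∀

  8*gaussExp+1-square : ∀ i M → ∃ λ s → 8 * gaussExp i M + 1 ≡ s * s
  8*gaussExp+1-square zero    M       = 4 * M + 1 , identity M
    where
    identity : ∀ M → 8 * (M * (2 * M + 1)) + 1 ≡ (4 * M + 1) * (4 * M + 1)
    identity = solve-∀
  8*gaussExp+1-square (suc i) zero    = 4 * i + 3 , identity i
    where
    identity : ∀ i → 8 * (suc i * (2 * i + 1)) + 1 ≡ (4 * i + 3) * (4 * i + 3)
    identity = solve-∀
  8*gaussExp+1-square (suc i) (suc M) = 8*gaussExp+1-square i M

  gaussTerm : ℕ → ℕ → Series
  gaussTerm M i = shift (gaussExp i M) (Q i)

  gaussSum : ℕ → Series
  gaussSum M = Σ∞ M (gaussTerm M)

  gaussProduct : ℕ → Series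
  gaussProduct M = poch∞ 1 4 · (Q 0 · poch 3 4 M)

  gaussTerm-summable : ∀ M → Summable M (gaussTerm M)
  gaussTerm-summable M = shifts-summable M (λ i → gaussExp i M) Q (λ i → i≤gaussExp+M i M)

  gaussSum-suc : ∀ M → let e = 3 + 4 * M in gaussSum M ⊕ shift e (gaussSum M) ≗ gaussSum (suc M)
  gaussSum-suc M = begin
    gaussSum M ⊕ shift e (gaussSum M)
      ≈⟨ ⊕-cong (Σ∞-cong G≗C⊕shift-G) (shift-cong e (Σ∞-uncons (gaussTerm-summable M))) ⟩
    Σ∞ M (λ i → C i ⊕ shift e (G (suc i))) ⊕ shift e (G 0 ⊕ Σ∞ M (G ∘ suc))
      ≈⟨ ⊕-cong (Σ∞-⊕ M C (λ i → shift e (G (suc i)))) (shift-⊕ e (G 0) (Σ∞ M (G ∘ suc))) ⟩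
    (Σ∞ M C ⊕ Σ∞ M (λ i → shift e (G (suc i)))) ⊕ (shift e (G 0) ⊕ shift e (Σ∞ M (G ∘ suc)))
      ≈⟨ ⊕-congˡ (Σ∞ M C ⊕ _) (⊕-comm (shift e (G 0)) (shift e (Σ∞ M (G ∘ suc)))) ⟩
    (Σ∞ M C ⊕ Σ∞ M (λ i → shift e (G (suc i)))) ⊕ (shift e (Σ∞ M (G ∘ suc)) ⊕ shift e (G 0))
      ≈⟨ ⊕-cong (⊕-congˡ (Σ∞ M C) (≗-sym (shift-Σ∞ e G∘suc-summable))) (λ _ → refl) ⟩
    (Σ∞ M C ⊕ shift e (Σ∞ M (G ∘ suc))) ⊕ (shift e (Σ∞ M (G ∘ suc)) ⊕ shift e (G 0))
      ≈⟨ ⊕-cancel-middle (Σ∞ M C) (shift e (Σ∞ M (G ∘ suc))) (shift e (G 0)) ⟩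
    Σ∞ M C ⊕ shift e (G 0)
      ≈⟨ ⊕-comm (Σ∞ M C) (shift e (G 0)) ⟩
    shift e (G 0) ⊕ Σ∞ M C
      ≈⟨ ⊕-cong first-term (Σ∞-mono (ℕₚ.n≤1+n M) C-summable) ⟩
    gaussTerm (suc M) 0 ⊕ Σ∞ (suc M) (gaussTerm (suc M) ∘ suc)
      ≈⟨ Σ∞-uncons (gaussTerm-summable (suc M)) ⟨
    gaussSum (suc M) ∎
    where
    open ≗-Reasoning
    e = 3 + 4 * M
    G = gaussTerm M
    C : ℕ → Series
    C i = shift (gaussExp i M) (Q (suc i))

    C-summable : Summable M C
    C-summable = shifts-summable M (λ i → gaussExp i M) (Q ∘ suc) (λ i → i≤gaussExp+M i M)

    G∘suc-summable : Summable M (G ∘ suc)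
    G∘suc-summable = shifts-summable M (λ i → gaussExp (suc i) M) (Q ∘ suc)
      (λ i → ℕₚ.≤-trans (ℕₚ.n≤1+n i) (i≤gaussExp+M (suc i) M))

    G≗C⊕shift-G : ∀ i → G i ≗ C i ⊕ shift e (G (suc i))
    G≗C⊕shift-G i = begin
      shift g (Q i)                                        ≈⟨ shift-cong g (Q-suc i) ⟩
      shift g (Q (suc i) ⊕ shift (4 * suc i) (Q (suc i))) ≈⟨ shift-⊕ g (Q (suc i)) _ ⟩
      C i ⊕ shift g (shift (4 * suc i) (Q (suc i)))
        ≈⟨ ⊕-congˡ (C i) (shift-shift g (4 * suc i) (Q (suc i))) ⟩
      C i ⊕ shift (g + 4 * suc i) (Q (suc i))
        ≈⟨ ⊕-congˡ (C i) (λ n → cong (λ x → shift x (Q (suc i)) n) (gaussExp-suc i M)) ⟩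
      C i ⊕ shift (e + gaussExp (suc i) M) (Q (suc i))
        ≈⟨ ⊕-congˡ (C i) (shift-shift e (gaussExp (suc i) M) (Q (suc i))) ⟨
      C i ⊕ shift e (G (suc i)) ∎
      where g = gaussExp i M

    first-term : shift e (G 0) ≗ gaussTerm (suc M) 0
    first-term n = trans (shift-shift e (gaussExp 0 M) (Q 0) n)
                         (cong (λ x → shift x (Q 0) n) (sym (gaussExp-0-suc M)))

  gaussProduct-suc : ∀ M → gaussProduct (suc M) ≗ 1+q^ (3 + 4 * M) · gaussProduct M
  gaussProduct-suc M = begin
    poch∞ 1 4 · (Q 0 · poch 3 4 (suc M))
      ≈⟨ ·-congˡ (poch∞ 1 4) (·-congˡ (Q 0) (poch-sucʳ 3 4 M)) ⟩
    poch∞ 1 4 · (Q 0 · (1+q^ e · poch 3 4 M))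
      ≈⟨ solve 4 (λ x y z w → x :* (y :* (z :* w)) := z :* (x :* (y :* w))) (λ _ → refl)
                 (poch∞ 1 4) (Q 0) (1+q^ e) _ ⟩
    1+q^ e · gaussProduct M                              ∎
    where
    open ≗-Reasoning
    e = 3 + 4 * M

  gauss : ∀ M → gaussProduct M ≗ gaussSum M
  gauss zero    = begin
    poch∞ 1 4 · (Q 0 · 1ˢ)
      ≈⟨ ·-congˡ (poch∞ 1 4) (λ n → trans (·-comm (Q 0) 1ˢ n) (·-identityˡ (Q 0) n)) ⟩
    eulerProduct 1                         ≈⟨ euler 0 ⟩
    eulerSum 1
      ≈⟨ Σ∞-cong (λ j n → cong (λ x → shift x (Q j) n) (sym (gaussExp-i-0 j))) ⟩
    gaussSum 0                             ∎
    where open ≗-Reasoning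
  gauss (suc M) = begin
    gaussProduct (suc M)                   ≈⟨ gaussProduct-suc M ⟩
    1+q^ e · gaussProduct M                ≈⟨ ·-congˡ (1+q^ e) (gauss M) ⟩
    1+q^ e · gaussSum M                    ≈⟨ 1+q^-· e (gaussSum M) ⟩
    gaussSum M ⊕ shift e (gaussSum M)      ≈⟨ gaussSum-suc M ⟩
    gaussSum (suc M)                       ∎
    where
    open ≗-Reasoning
    e = 3 + 4 * M

module T₂Parity where

  open 𝔽₂Series
  open PodParity
  open EulerExpansion using (Q)
  open GaussExpansion

  parity-T₂ : ∀ n → parity (T₂ n) ≡ cube podParity n
  parity-T₂ n = begin
    parity (T₂ n)                                      ≡⟨ cong parity (NatSeries.T₂≡cube-pod n) ⟩
    parity (NatSeries.cube pod n)                      ≡⟨ Parity.map-· pod (pod NatSeries.· pod) n ⟩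
    (podParity · (parity ∘ (pod NatSeries.· pod))) n   ≡⟨ ·-congˡ podParity (Parity.map-· pod pod) n ⟩
    cube podParity n                                   ∎
    where open ≡-Reasoning

  cube-podParity≗[]gaussProduct : ∀ {d M} → d < 3 + 4 * M → cube podParity ≗[ d ] gaussProduct M
  cube-podParity≗[]gaussProduct {d} {M} d<3+4M = ≗[]-trans (≗⇒≗[] (λ n → begin
    cube podParity n                                 ≡⟨ ·-cong D (·-cong D D) n ⟩
    cube (poch∞ 1 1) n                               ≡⟨ cube-poch∞-1-1 n ⟩
    (poch∞ 1 4 · (Q 0 · poch∞ 3 4)) n                ∎))
    (·-cong≤ ≗[]-refl (·-cong≤ ≗[]-refl (poch∞-approx 3 4 M d<3+4M)))
    where
    open ≡-Reasoning
    D = podParity≗poch∞-1-1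

  -- Only the terms with i > d can reach degree ≤ d, and for those Q i ≗[ d ] 1ˢ.
  gaussSum-true : ∀ {d n} → n ≤ d → gaussSum (suc (d + d)) n ≡ true → ∃ λ i → n ≡ gaussExp i (suc (d + d))
  gaussSum-true {d} {n} n≤d sum≡true = i , ℕₚ.≤-antisym (ℕₚ.m∸n≡0⇒m≤n n∸E≡0) E≤n
    where
    M = suc (d + d)
    found = Σ<≡true⇒∃ (suc (n + M)) sum≡true
    i = proj₁ found
    E = gaussExp i M
    split = shift≡true E (Q i) (proj₂ found)
    E≤n = proj₁ split
    d<i : d < i
    d<i = ℕₚ.+-cancelˡ-< d d i (ℕₚ.≤-trans (M≤gaussExp+i i M) (ℕₚ.+-monoˡ-≤ i (ℕₚ.≤-trans E≤n n≤d)))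
    n∸E≤d : n ∸ E ≤ d
    n∸E≤d = ℕₚ.≤-trans (ℕₚ.m∸n≤m n E) n≤d
    n∸E≡0 : n ∸ E ≡ 0
    n∸E≡0 = poch∞≡true 4 (<⇒<+* 0 4 (ℕₚ.≤-<-trans n∸E≤d (ℕₚ.<-trans d<i (ℕₚ.n<1+n i)))) (proj₂ split)

  T₂-odd⇒square : ∀ n → parity (T₂ n) ≡ true → ∃ λ s → 8 * n + 1 ≡ s * s
  T₂-odd⇒square n odd = subst (λ m → ∃ λ s → 8 * m + 1 ≡ s * s) (sym n≡E) (8*gaussExp+1-square i M)
    where
    M = suc (n + n)
    coeff≡true : gaussSum M n ≡ true
    coeff≡true = begin
      gaussSum M n        ≡⟨ gauss M n ⟨
      gaussProduct M n
        ≡⟨ cube-podParity≗[]gaussProduct {n} {M} (<⇒<+* 3 4 (ℕₚ.m≤m+n (suc n) n)) n ℕₚ.≤-refl ⟨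
      cube podParity n    ≡⟨ parity-T₂ n ⟨
      parity (T₂ n)       ≡⟨ odd ⟩
      true                ∎
      where open ≡-Reasoning
    found = gaussSum-true {n} {n} ℕₚ.≤-refl coeff≡true
    i = proj₁ found
    n≡E = proj₂ found

isQRᵇ-complete : ∀ a q x → (x * x) % suc q ≡ a % suc q → T (isQRᵇ a (suc q))
isQRᵇ-complete a q x x²≡a = any⁺ residue (Any.map (λ x%p≡y → subst (T ∘ residue) x%p≡y x%p-residue)
                                                   (∈-upTo⁺ (m%n<n x (suc q))))
  where
  residue : ℕ → Bool
  residue y = ((y * y) % suc q) ≡ᵇ (a % suc q)
  x%p-residue : T (residue (x % suc q))
  x%p-residue = ℕₚ.≡⇒≡ᵇ _ _ (trans (sym (%-distribˡ-* x x (suc q))) x²≡a)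

residue⇒legendre≢-1 : ∀ a q → T (isQRᵇ a (suc q)) → legendre a (suc q) ≢ -[1+ 0 ]
residue⇒legendre≢-1 a q qr with (a % suc q) ≡ᵇ 0 | isQRᵇ a (suc q)
... | true  | _     = λ ()
... | false | true  = λ ()
... | false | false = ⊥-elim qr

legendre≡-1⇒non-residue : ∀ a q x → legendre a (suc q) ≡ -[1+ 0 ] → (x * x) % suc q ≢ a % suc q
legendre≡-1⇒non-residue a q x leg x²≡a = residue⇒legendre≢-1 a q (isQRᵇ-complete a q x x²≡a) leg

square≡9*⇒square : ∀ {k} s → s * s ≡ 9 * k → ∃ λ t → t * t ≡ k
square≡9*⇒square {k} s s²≡9k = [ root , root ]′ (euclidsLemma s s 3-prime 3∣s²)
  where
  3-prime : Prime 3
  3-prime = from-yes (prime? 3)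

  9k≡3k*3 : ∀ k → 9 * k ≡ 3 * k * 3
  9k≡3k*3 = solve-∀

  3∣s² : 3 ∣ s * s
  3∣s² = divides (3 * k) (trans s²≡9k (9k≡3k*3 k))

  root : 3 ∣ s → ∃ λ t → t * t ≡ k
  root (divides t s≡t*3) = t , ℕₚ.*-cancelʳ-≡ (t * t) k 9 (begin
    t * t * 9         ≡⟨ regroup t ⟩
    t * 3 * (t * 3)   ≡⟨ cong₂ _*_ s≡t*3 s≡t*3 ⟨
    s * s             ≡⟨ s²≡9k ⟩
    9 * k             ≡⟨ ℕₚ.*-comm 9 k ⟩
    k * 9             ∎)
    where
    open ≡-Reasoning
    regroup : ∀ t → t * t * 9 ≡ t * 3 * (t * 3)
    regroup = solve-∀

8[9m+1]+1≢square : ∀ q r n → legendre (8 * r + 1) (suc q) ≡ -[1+ 0 ] →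
                   ∀ s → 8 * (9 * (suc q * n + r) + 1) + 1 ≢ s * s
8[9m+1]+1≢square q r n leg s square = legendre≡-1⇒non-residue (8 * r + 1) q t leg t²≡8r+1
  where
  p = suc q
  root = square≡9*⇒square s (trans (sym square) (identity (p * n + r)))
    where
    identity : ∀ m → 8 * (9 * m + 1) + 1 ≡ 9 * (8 * m + 1)
    identity = solve-∀
  t = proj₁ root
  t²≡8r+1 : (t * t) % p ≡ (8 * r + 1) % p
  t²≡8r+1 = trans (cong (_% p) (trans (proj₂ root) (identity p n r))) ([m+kn]%n≡m%n (8 * r + 1) (8 * n) p)
    where
    identity : ∀ p n r → 8 * (p * n + r) + 1 ≡ 8 * r + 1 + 8 * n * p
    identity = solve-∀

theorem1p5 : (p r : ℕ) → Prime p → 3 ≤ p → 1 ≤ r → r ≤ p ∸ 1 →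
    legendre (8 * r + 1) p ≡ -[1+ 0 ] →
    (n : ℕ) → 6 ∣ T₂ (9 * (p * n + r) + 1)
theorem1p5 zero    _ _ _ _ _ ()
theorem1p5 (suc q) r _ _ _ _ leg n = lcm-least {2} {3} T₂-even 3∣T₂
  where
  m = suc q * n + r

  T₂-even : 2 ∣ T₂ (9 * m + 1)
  T₂-even = parity≡false⇒2∣ (T₂ (9 * m + 1)) (¬-not λ odd →
    let (s , square) = T₂Parity.T₂-odd⇒square (9 * m + 1) odd in 8[9m+1]+1≢square q r n leg s square)

  3∣T₂ : 3 ∣ T₂ (9 * m + 1)
  3∣T₂ = subst (λ k → 3 ∣ T₂ k) (identity m) (NatSeries.3∣T₂[1+3k] (3 * m))
    where
    identity : ∀ m → suc (3 * m * 3) ≡ 9 * m + 1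
    identity = solve-∀
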